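{- Let $M$ be a finite subset of $\mathbb N^+$, $r\in\mathbb N$ and $k\in\mathbb N$ with $k>1$. Put $f(r):=(2^{kr+1}-2)\,\mathrm{lcm}(M)$. Then for all $\ell_1,\ell_2\in\mathbb N^+$ with $\ell_1=^M_{f(r)}\ell_2$ we have $\mathfrak G_{k\ell_1}\equiv_r^M\mathfrak G_{k\ell_2}$.
   Context: $\mathrm{lcm}(M)$ is the least common multiple of the elements of $M$, with $\mathrm{lcm}(\emptyset)=1$. For $a,b,t\in\mathbb N$, $a=^M_t b$ means that either $a=b$, or $a,b\ge t$ and $a\equiv b\pmod m$ for all $m\in M$. For $k,\ell\in\mathbb N^+$, the cliquey $(k,\ell)$-grid $\mathfrak G_{k\ell}$ is the $\{\sim_h,\sim_v\}$-structure with universe $\{0,\dots,k-1\}\times\{0,\dots,\ell-1\}$, where $(x,y)\sim_h(x',y')$ iff $x=x'$ and $(x,y)\sim_v(x',y')$ iff $y=y'$. For $r\in\mathbb N$, $\mathfrak A\equiv_r^M\mathfrak B$ means that $\mathfrak A$ and $\mathfrak B$ satisfy the same sentences of $\mathrm{CMSO}^{(M)}$ of quantifier rank at most $r$, where $\mathrm{CMSO}^{(M)}$ is monadic second-order logic extended by atomic predicates $C^{(m,q)}(X)$ ($X$ a set variable, $m\in M$, $0\le q<m$) expressing $|X|\equiv q\pmod m$, and quantifier rank counts first-order and set quantifiers as in MSO. -}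

module Defs where

open import Data.Nat using (ℕ; zero; suc; _+_; _*_; _∸_; _^_; _≤_; _<_; ∣_-_∣)
open import Data.Nat.Divisibility using (_∣_)
open import Data.Nat.LCM using (lcm)
open import Data.Fin using (Fin; zero; suc; remQuot)
open import Data.Fin.Subset using (Subset) renaming (_∈_ to _∈ₛ_; ∣_∣ to ∣_∣ₛ)
open import Data.List using (List; foldr)
open import Data.List.Membership.Propositional using (_∈_)
open import Data.List.Relation.Unary.All using (All)
open import Data.Product using (_×_; proj₁; proj₂; Σ; _,_)
open import Data.Sum using (_⊎_)
open import Data.Empty using (⊥)
open import Function.Bundles using (_⇔_)
open import Relation.Binary.PropositionalEquality using (_≡_)

_≡_[mod_] : ℕ → ℕ → ℕ → Set
a ≡ b [mod m ] = m ∣ ∣ a - b ∣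

-- lcm of a finite set (given as a list), lcm(∅) = 1
lcmL : List ℕ → ℕ
lcmL = foldr lcm 1

EqM : List ℕ → ℕ → ℕ → ℕ → Set
EqM M t a b = a ≡ b ⊎ (t ≤ a × t ≤ b × All (λ m → a ≡ b [mod m ]) M)

-- finite {∼h, ∼v}-structures with universe Fin n
record Structure : Set₁ where
  field
    size : ℕ
    H    : Fin size → Fin size → Set
    V    : Fin size → Fin size → Set
open Structure public

-- cliquey (k,ℓ)-grid: universe {0..k-1}×{0..ℓ-1}, encoded as Fin (k * ℓ) via remQuot
grid : ℕ → ℕ → Structure
grid k ℓ = record
  { size = k * ℓ
  ; H = λ i j → proj₁ (remQuot {k} ℓ i) ≡ proj₁ (remQuot {k} ℓ j)
  ; V = λ i j → proj₂ (remQuot {k} ℓ i) ≡ proj₂ (remQuot {k} ℓ j)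
  }

-- CMSO^(M) formulas with p free first-order and q free set variables (de Bruijn)
data Formula (M : List ℕ) (p q : ℕ) : Set where
  eq    : Fin p → Fin p → Formula M p q
  relH  : Fin p → Fin p → Formula M p q
  relV  : Fin p → Fin p → Formula M p q
  mem   : Fin p → Fin q → Formula M p q
  card  : (m : ℕ) → m ∈ M → (r : ℕ) → r < m → Fin q → Formula M p q
  neg   : Formula M p q → Formula M p q
  and   : Formula M p q → Formula M p q → Formula M p q
  or    : Formula M p q → Formula M p q → Formula M p q
  ex1   : Formula M (suc p) q → Formula M p q
  all1  : Formula M (suc p) q → Formula M p q
  ex2   : Formula M p (suc q) → Formula M p q
  all2  : Formula M p (suc q) → Formula M p q

max : ℕ → ℕ → ℕ
max zero n = n
max (suc m) zero = suc m
max (suc m) (suc n) = suc (max m n)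

qr : ∀ {M p q} → Formula M p q → ℕ
qr (eq _ _) = 0
qr (relH _ _) = 0
qr (relV _ _) = 0
qr (mem _ _) = 0
qr (card _ _ _ _ _) = 0
qr (neg φ) = qr φ
qr (and φ ψ) = max (qr φ) (qr ψ)
qr (or φ ψ) = max (qr φ) (qr ψ)
qr (ex1 φ) = suc (qr φ)
qr (all1 φ) = suc (qr φ)
qr (ex2 φ) = suc (qr φ)
qr (all2 φ) = suc (qr φ)

extend : ∀ {A : Set} {p} → (Fin p → A) → A → Fin (suc p) → A
extend ρ a zero = a
extend ρ a (suc i) = ρ i

Sat : ∀ {M p q} (A : Structure) → Formula M p q
    → (Fin p → Fin (size A)) → (Fin q → Subset (size A)) → Set
Sat A (eq x y) ρ σ = ρ x ≡ ρ y
Sat A (relH x y) ρ σ = H A (ρ x) (ρ y)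
Sat A (relV x y) ρ σ = V A (ρ x) (ρ y)
Sat A (mem x X) ρ σ = ρ x ∈ₛ σ X
Sat A (card m _ r _ X) ρ σ = ∣ σ X ∣ₛ ≡ r [mod m ]
Sat A (neg φ) ρ σ = Sat A φ ρ σ → ⊥
Sat A (and φ ψ) ρ σ = Sat A φ ρ σ × Sat A ψ ρ σ
Sat A (or φ ψ) ρ σ = Sat A φ ρ σ ⊎ Sat A ψ ρ σ
Sat A (ex1 φ) ρ σ = Σ (Fin (size A)) λ a → Sat A φ (extend ρ a) σ
Sat A (all1 φ) ρ σ = (a : Fin (size A)) → Sat A φ (extend ρ a) σ
Sat A (ex2 φ) ρ σ = Σ (Subset (size A)) λ X → Sat A φ ρ (extend σ X)
Sat A (all2 φ) ρ σ = (X : Subset (size A)) → Sat A φ ρ (extend σ X)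

empty : ∀ {A : Set} → Fin 0 → A
empty ()

_⊨_ : ∀ {M} → Structure → Formula M 0 0 → Set
A ⊨ φ = Sat A φ empty empty

EquivCMSO : List ℕ → ℕ → Structure → Structure → Set
EquivCMSO M r A B = (φ : Formula M 0 0) → qr φ ≤ r → (A ⊨ φ) ⇔ (B ⊨ φ)

module Submission where

-- Proof by a back-and-forth argument.  An assignment of points and sets
-- colours every row by what the variables do in it.  Two assignments
-- correspond at threshold t when, for every colour, the numbers of rows of
-- that colour are equal, or both at least t and congruent modulo L = lcm M,
-- and exactly equal for rows holding a point.  Corresponding assignments
-- agree on atomic formulas (a set size is a weighted sum of colour counts).
-- Answering a point costs one unit of threshold; answering a set refines
-- every colour by k bits, each bit handled by the splitting lemma
-- (a ≈[2s+L] b lets every part of a be matched at threshold s).  The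
-- threshold so needed for rank r is exactly f(r)/2.

open import Defs
open import Data.Nat using (ℕ; _+_; _*_; _∸_; _^_; _≤_; _<_)
open import Data.List using (List; []; _∷_)
open import Data.List.Relation.Unary.All using (All; []; _∷_)

open import Data.Bool using (Bool; true; false; _∧_; _∨_; not)
open import Data.Bool.Properties using (∧-zeroʳ; ∧-assoc; ∧-identityʳ) renaming (_≟_ to _≟ᵇ_)
open import Data.Fin using (Fin; zero; suc; _↑ˡ_; _↑ʳ_; combine; remQuot)
open import Data.Fin.Properties using (remQuot-combine; combine-remQuot) renaming (_≟_ to _≟ᶠ_)
open import Data.Fin.Subset using (Subset) renaming (∣_∣ to ∣_∣ₛ)
open import Data.List.Membership.Propositional using (_∈_)
open import Data.List.Relation.Unary.Any using (here; there)
open import Data.Nat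
  using (zero; suc; NonZero; >-nonZero⁻¹; >-nonZero; ≢-nonZero; ≢-nonZero⁻¹;
         z≤n; s≤s; ∣_-_∣; _<?_; _%_; _/_; _⊓_; _<ᵇ_)
open import Data.Nat.DivMod using (m%n<n; m≡m%n+[m/n]*n)
open import Data.Nat.Divisibility using (_∣_; divides; ∣m+n∣m⇒∣n; ∣-trans; 1∣_)
open import Data.Nat.GCD using (gcd)
open import Data.Nat.LCM using (lcm; m∣lcm[m,n]; n∣lcm[m,n]; lcm-least; gcd*lcm)
open import Data.Nat.Properties hiding (_≟_)
open import Data.Nat.Properties using () renaming (_≟_ to _≟ⁿ_)
open import Algebra.Properties.CommutativeMonoid.Sum +-0-commutativeMonoid
  using (sum; sum-cong-≗; ∑-distrib-+; ∑-comm; sum-replicate-zero)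
open import Algebra.Properties.CommutativeSemigroup +-commutativeSemigroup
  using (x∙yz≈xz∙y; xy∙z≈xz∙y)
open import Algebra.Properties.CommutativeSemigroup *-commutativeSemigroup
  using (x∙yz≈y∙xz)
open import Algebra.Properties.Semiring.Sum +-*-semiring using (*-distribˡ-sum)
open import Data.Nat.Tactic.RingSolver using (solve-∀)
open import Data.Product using (Σ; _×_; _,_; proj₁; proj₂)
open import Data.Sum using (_⊎_; inj₁; inj₂; [_,_]′)
open import Data.Vec using (Vec; []; _∷_; head; tail; lookup; tabulate)
import Data.Vec.Properties as Vec
open import Function.Bundles using (mk⇔)
open import Relation.Binary.Definitions using (DecidableEquality)
open import Relation.Binary.PropositionalEquality
open import Relation.Nullary using (Dec; yes; no; does; contradiction)
open import Relation.Nullary.Decidable using (map′; _×-dec_; dec-true; dec-false)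

private
  variable
    a b c d s t t′ ℓ ℓA ℓB : ℕ

max-left : ∀ m n → m ≤ max m n
max-left zero    n       = z≤n
max-left (suc m) zero    = ≤-refl
max-left (suc m) (suc n) = s≤s (max-left m n)

max-right : ∀ m n → n ≤ max m n
max-right zero    n       = ≤-refl
max-right (suc m) zero    = z≤n
max-right (suc m) (suc n) = s≤s (max-right m n)

does⇒witness : {A : Set} (a? : Dec A) → does a? ≡ true → A
does⇒witness (yes a) _ = a

𝟙 : Bool → ℕ
𝟙 true  = 1
𝟙 false = 0

𝟙-∧ : ∀ x y → 𝟙 (x ∧ y) ≡ 𝟙 x * 𝟙 y
𝟙-∧ true  y = sym (+-identityʳ (𝟙 y))
𝟙-∧ false y = refl

count : ∀ {n} → (Fin n → Bool) → ℕ
count P = sum (λ i → 𝟙 (P i))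

count-cong : ∀ {n} {P Q : Fin n → Bool} → (∀ i → P i ≡ Q i) → count P ≡ count Q
count-cong P≗Q = sum-cong-≗ (λ i → cong 𝟙 (P≗Q i))

count-false : ∀ n → count {n} (λ _ → false) ≡ 0
count-false n = sum-replicate-zero n

count-true : ∀ n → count {n} (λ _ → true) ≡ n
count-true zero    = refl
count-true (suc n) = cong suc (count-true n)

count-split : ∀ {n} (P h : Fin n → Bool) →
              count P ≡ count (λ i → h i ∧ P i) + count (λ i → not (h i) ∧ P i)
count-split P h =
  trans (sum-cong-≗ pointwise) (∑-distrib-+ (λ i → 𝟙 (h i ∧ P i)) (λ i → 𝟙 (not (h i) ∧ P i)))
  where
  pointwise : ∀ i → 𝟙 (P i) ≡ 𝟙 (h i ∧ P i) + 𝟙 (not (h i) ∧ P i)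
  pointwise i with h i
  ... | true  = sym (+-identityʳ _)
  ... | false = refl

count-witness : ∀ {n} (P : Fin n → Bool) → 1 ≤ count P → Σ (Fin n) λ i → P i ≡ true
count-witness {suc n} P 1≤count with P zero in P0
... | true  = zero , P0
... | false = let (i , Pi) = count-witness (λ i → P (suc i)) 1≤count in suc i , Pi

count-nonzero : ∀ {n} (P : Fin n → Bool) i → P i ≡ true → 1 ≤ count P
count-nonzero P zero    P0 rewrite P0 = s≤s z≤n
count-nonzero P (suc i) Pi =
  ≤-trans (count-nonzero (λ i → P (suc i)) i Pi) (m≤n+m _ (𝟙 (P zero)))

count-at : ∀ {n} (y : Fin n) (P : Fin n → Bool) →
           count (λ z → does (y ≟ᶠ z) ∧ P z) ≡ 𝟙 (P y)
count-at {suc n} zero    P = trans (cong (𝟙 (P zero) +_) (count-false n)) (+-identityʳ _)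
count-at {suc n} (suc y) P = count-at y (λ z → P (suc z))

count-except : ∀ {n} (y : Fin n) (P : Fin n → Bool) →
               count (λ z → not (does (y ≟ᶠ z)) ∧ P z) ≡ count P ∸ 𝟙 (P y)
count-except y P = begin
  count except               ≡⟨ m+n∸m≡n (𝟙 (P y)) (count except) ⟨
  𝟙 (P y) + count except ∸ 𝟙 (P y) ≡⟨ cong (_∸ 𝟙 (P y)) y-and-rest ⟨
  count P ∸ 𝟙 (P y)          ∎
  where
  open ≡-Reasoning
  except : _ → Bool
  except z = not (does (y ≟ᶠ z)) ∧ P z
  y-and-rest : count P ≡ 𝟙 (P y) + count except
  y-and-rest = trans (count-split P (λ z → does (y ≟ᶠ z))) (cong (_+ count except) (count-at y P))

sum-↑ : ∀ m {n} (f : Fin (m + n) → ℕ) →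
        sum f ≡ sum (λ i → f (i ↑ˡ n)) + sum (λ i → f (m ↑ʳ i))
sum-↑ zero    f = refl
sum-↑ (suc m) f = trans (cong (f zero +_) (sum-↑ m (λ i → f (suc i)))) (sym (+-assoc (f zero) _ _))

sum-combine : ∀ m {n} (f : Fin (m * n) → ℕ) →
              sum f ≡ sum {m} (λ x → sum {n} (λ y → f (combine x y)))
sum-combine zero        f = refl
sum-combine (suc m) {n} f =
  trans (sum-↑ n f) (cong (sum (λ y → f (y ↑ˡ (m * n))) +_) (sum-combine m (λ i → f (n ↑ʳ i))))

-- Unlike the divisibility form used in the statement, this is
-- closed under the arithmetic below without any case analysis on ≤.
module Congruence (L : ℕ) where

  infix 4 _≈_
  _≈_ : ℕ → ℕ → Set
  a ≈ b = Σ ℕ λ u → Σ ℕ λ v → a + u * L ≡ b + v * L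

  private
    regroup : ∀ a c u u′ L → a + c + (u + u′) * L ≡ (a + u * L) + (c + u′ * L)
    regroup = solve-∀
    scale : ∀ g a u L → g * a + g * u * L ≡ g * (a + u * L)
    scale = solve-∀

  ≈-refl : a ≈ a
  ≈-refl = 0 , 0 , refl

  ≈-reflexive : a ≡ b → a ≈ b
  ≈-reflexive refl = ≈-refl

  ≈-sym : a ≈ b → b ≈ a
  ≈-sym (u , v , e) = v , u , sym e

  +-cong : a ≈ b → c ≈ d → a + c ≈ b + d
  +-cong {a} {b} {c} {d} (u , v , e) (u′ , v′ , e′) = u + u′ , v + v′ , (begin
    a + c + (u + u′) * L        ≡⟨ regroup a c u u′ L ⟩
    (a + u * L) + (c + u′ * L) ≡⟨ cong₂ _+_ e e′ ⟩
    (b + v * L) + (d + v′ * L) ≡⟨ sym (regroup b d v v′ L) ⟩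
    b + d + (v + v′) * L        ∎)
    where open ≡-Reasoning

  +-cancelʳ : a + c ≈ b + d → c ≈ d → a ≈ b
  +-cancelʳ {a} {c} {b} {d} a+c≈b+d c≈d with +-cong a+c≈b+d (≈-sym c≈d)
  ... | u , v , e = u , v , +-cancelʳ-≡ (c + d) _ _ (begin
    a + u * L + (c + d)   ≡⟨ xy∙z≈xz∙y a (u * L) (c + d) ⟩
    a + (c + d) + u * L   ≡⟨ cong (_+ u * L) (sym (+-assoc a c d)) ⟩
    a + c + d + u * L     ≡⟨ e ⟩
    b + d + c + v * L     ≡⟨ cong (_+ v * L) (trans (+-assoc b d c) (cong (b +_) (+-comm d c))) ⟩
    b + (c + d) + v * L   ≡⟨ xy∙z≈xz∙y b (c + d) (v * L) ⟩
    b + v * L + (c + d)   ∎)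
    where open ≡-Reasoning

  ≈-trans : a ≈ b → b ≈ c → a ≈ c
  ≈-trans {a} {b} {c} a≈b b≈c =
    +-cancelʳ (subst (a + b ≈_) (+-comm b c) (+-cong a≈b b≈c)) (≈-refl {b})

  *-congˡ : ∀ g → a ≈ b → g * a ≈ g * b
  *-congˡ {a} {b} g (u , v , e) = g * u , g * v , (begin
    g * a + g * u * L ≡⟨ scale g a u L ⟩
    g * (a + u * L)   ≡⟨ cong (g *_) e ⟩
    g * (b + v * L)   ≡⟨ scale g b v L ⟨
    g * b + g * v * L ∎)
    where open ≡-Reasoning

  ∸-cong : c ≤ a → d ≤ b → a ≈ b → c ≈ d → a ∸ c ≈ b ∸ d
  ∸-cong c≤a d≤b a≈b c≈d =
    +-cancelʳ (subst₂ _≈_ (sym (m∸n+n≡m c≤a)) (sym (m∸n+n≡m d≤b)) a≈b) c≈d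

  sum-cong : ∀ {n} {f g : Fin n → ℕ} → (∀ i → f i ≈ g i) → sum f ≈ sum g
  sum-cong {zero}  f≈g = ≈-refl
  sum-cong {suc n} f≈g = +-cong (f≈g zero) (sum-cong (λ i → f≈g (suc i)))

  ∣⇒≈ : L ∣ ∣ a - b ∣ → a ≈ b
  ∣⇒≈ {a} {b} (divides w d≡wL) with ≤-total a b
  ... | inj₁ a≤b = w , 0 , (begin
    a + w * L     ≡⟨ cong (a +_) (trans (sym d≡wL) (m≤n⇒∣m-n∣≡n∸m a≤b)) ⟩
    a + (b ∸ a)   ≡⟨ m+[n∸m]≡n a≤b ⟩
    b             ≡⟨ sym (+-identityʳ b) ⟩
    b + 0 * L     ∎)
    where open ≡-Reasoning
  ... | inj₂ b≤a = ≈-sym (w , 0 , (begin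
    b + w * L     ≡⟨ cong (b +_) (trans (sym d≡wL) (m≤n⇒∣n-m∣≡n∸m b≤a)) ⟩
    b + (a ∸ b)   ≡⟨ m+[n∸m]≡n b≤a ⟩
    a             ≡⟨ sym (+-identityʳ a) ⟩
    a + 0 * L     ∎))
    where open ≡-Reasoning

  ≤∧≈⇒∣ : a ≤ b → a ≈ b → L ∣ b ∸ a
  ≤∧≈⇒∣ {a} {b} a≤b (u , v , e) = ∣m+n∣m⇒∣n (divides u (+-cancelˡ-≡ a _ _ (begin
    a + (v * L + (b ∸ a)) ≡⟨ x∙yz≈xz∙y a (v * L) (b ∸ a) ⟩
    a + (b ∸ a) + v * L   ≡⟨ cong (_+ v * L) (m+[n∸m]≡n a≤b) ⟩
    b + v * L             ≡⟨ sym e ⟩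
    a + u * L             ∎))) (divides v refl)
    where open ≡-Reasoning

  ≈⇒∣ : a ≈ b → L ∣ ∣ a - b ∣
  ≈⇒∣ {a} {b} a≈b with ≤-total a b
  ... | inj₁ a≤b = subst (L ∣_) (sym (m≤n⇒∣m-n∣≡n∸m a≤b)) (≤∧≈⇒∣ a≤b a≈b)
  ... | inj₂ b≤a = subst (L ∣_) (sym (m≤n⇒∣n-m∣≡n∸m b≤a)) (≤∧≈⇒∣ b≤a (≈-sym a≈b))

≈-divisor : ∀ {m L} → m ∣ L → Congruence._≈_ L a b → Congruence._≈_ m a b
≈-divisor {a} {b} {m} (divides w refl) (u , v , e) = u * w , v * w ,
  trans (cong (a +_) (*-assoc u w m)) (trans e (cong (b +_) (sym (*-assoc v w m))))

transfer-mod : ∀ {m L r} → m ∣ L → Congruence._≈_ L a b → m ∣ ∣ a - r ∣ → m ∣ ∣ b - r ∣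
transfer-mod {m = m} m∣L a≈b a≡r = ≈⇒∣ (≈-trans (≈-sym (≈-divisor m∣L a≈b)) (∣⇒≈ a≡r))
  where open Congruence m

-- For L = lcm M this is the relation
-- =^M_t of the statement; the threshold t is what the quantifier rank
-- consumes.
module Threshold (L : ℕ) where
  open Congruence L

  infix 4 _≈[_]_
  _≈[_]_ : ℕ → ℕ → ℕ → Set
  a ≈[ t ] b = a ≡ b ⊎ (t ≤ a × t ≤ b × a ≈ b)

  ≈[]-sym : a ≈[ t ] b → b ≈[ t ] a
  ≈[]-sym (inj₁ a≡b)            = inj₁ (sym a≡b)
  ≈[]-sym (inj₂ (t≤a , t≤b , a≈b)) = inj₂ (t≤b , t≤a , ≈-sym a≈b)

  ≈[]-weaken : t′ ≤ t → a ≈[ t ] b → a ≈[ t′ ] b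
  ≈[]-weaken t′≤t (inj₁ a≡b)            = inj₁ a≡b
  ≈[]-weaken t′≤t (inj₂ (t≤a , t≤b , a≈b)) =
    inj₂ (≤-trans t′≤t t≤a , ≤-trans t′≤t t≤b , a≈b)

  ≈[]⇒≈ : a ≈[ t ] b → a ≈ b
  ≈[]⇒≈ (inj₁ a≡b)          = ≈-reflexive a≡b
  ≈[]⇒≈ (inj₂ (_ , _ , a≈b)) = a≈b

  ≈[]-nonzero : 1 ≤ t → a ≈[ t ] b → 1 ≤ a → 1 ≤ b
  ≈[]-nonzero _   (inj₁ refl)          1≤a = 1≤a
  ≈[]-nonzero 1≤t (inj₂ (_ , t≤b , _)) _   = ≤-trans 1≤t t≤b

  ≈[]-pred : suc t′ ≤ t → a ≈[ t ] b → a ∸ 1 ≈[ t′ ] b ∸ 1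
  ≈[]-pred _ (inj₁ refl) = inj₁ refl
  ≈[]-pred {t′} st′≤t (inj₂ (t≤a , t≤b , a≈b)) =
    inj₂ (∸-monoˡ-≤ 1 (≤-trans st′≤t t≤a) , ∸-monoˡ-≤ 1 (≤-trans st′≤t t≤b) ,
          ∸-cong (≤-trans (s≤s z≤n) (≤-trans st′≤t t≤a))
                 (≤-trans (s≤s z≤n) (≤-trans st′≤t t≤b)) a≈b ≈-refl)

  private
    within : d ≤ s + L → d ≤ s + s + L
    within {d} {s} d≤s+L =
      ≤-trans d≤s+L (≤-trans (m≤n+m (s + L) s) (≤-reflexive (sym (+-assoc s s L))))

    room : s + s + L ≤ c → d ≤ s + L → s ≤ c ∸ d
    room {s} {c} {d} big≤c d≤s+L = m+n≤o⇒m≤o∸n s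
      (≤-trans (+-monoʳ-≤ s d≤s+L) (≤-trans (≤-reflexive (sym (+-assoc s s L))) big≤c))

    short : d < s → d ≤ s + L
    short {d} {s} d<s = ≤-trans (<⇒≤ d<s) (m≤m+n s L)

  ≈[]-∸𝟙 : suc t′ ≤ t → a ≈[ t ] b → ∀ e → a ∸ 𝟙 e ≈[ t′ ] b ∸ 𝟙 e
  ≈[]-∸𝟙 st′≤t a≈b true  = ≈[]-pred st′≤t a≈b
  ≈[]-∸𝟙 st′≤t a≈b false = ≈[]-weaken (≤-trans (n≤1+n _) st′≤t) a≈b

  record MatchingPart (s a b a₁ : ℕ) : Set where
    field
      part        : ℕ
      part≤       : part ≤ b
      parts       : a₁ ≈[ s ] part
      complements : a ∸ a₁ ≈[ s ] b ∸ part
      exact       : a ≡ b → a₁ ≡ part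

  -- This is what lets a set quantifier cut a class of
  -- rows in two.
  split : .{{NonZero L}} → ∀ s {a b a₁} → a₁ ≤ a → a ≈[ s + s + L ] b → MatchingPart s a b a₁
  split s {a} {b} {a₁} a₁≤a a≈b with a ≟ⁿ b
  ... | yes refl = record { part = a₁ ; part≤ = a₁≤a ; parts = inj₁ refl
                          ; complements = inj₁ refl ; exact = λ _ → refl }
  split s {a} {b} {a₁} a₁≤a (inj₁ a≡b) | no a≢b = contradiction a≡b a≢b
  split s {a} {b} {a₁} a₁≤a (inj₂ (big≤a , big≤b , a≈b)) | no a≢b with a₁ <? s | a ∸ a₁ <? s
  ... | yes a₁<s | _ = record
    { part = a₁ ; part≤ = ≤-trans (within (short a₁<s)) big≤b ; parts = inj₁ refl
    ; complements = inj₂ (room big≤a (short a₁<s) , room big≤b (short a₁<s) ,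
                          ∸-cong a₁≤a (≤-trans (within (short a₁<s)) big≤b) a≈b ≈-refl)
    ; exact = λ _ → refl }
  ... | no a₁≮s | yes rest<s = record
    { part = b ∸ (a ∸ a₁) ; part≤ = m∸n≤m b (a ∸ a₁)
    ; parts = inj₂ (≮⇒≥ a₁≮s , room big≤b (short rest<s) ,
                    subst (_≈ b ∸ (a ∸ a₁)) (m∸[m∸n]≡n a₁≤a)
                          (∸-cong (m∸n≤m a a₁) rest≤b a≈b ≈-refl))
    ; complements = inj₁ (sym (m∸[m∸n]≡n rest≤b))
    ; exact = λ a≡b → contradiction a≡b a≢b }
    where
    rest≤b : a ∸ a₁ ≤ b
    rest≤b = ≤-trans (within (short rest<s)) big≤b
  ... | no a₁≮s | no rest≮s = record
    { part = s + r ; part≤ = s+r≤b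
    ; parts = inj₂ (≮⇒≥ a₁≮s , m≤m+n s r , a₁≈s+r)
    ; complements = inj₂ (≮⇒≥ rest≮s , room big≤b (<⇒≤ s+r<s+L) ,
                          ∸-cong a₁≤a s+r≤b a≈b a₁≈s+r)
    ; exact = λ a≡b → contradiction a≡b a≢b }
    where
    r : ℕ
    r = (a₁ ∸ s) % L
    s+r<s+L : s + r < s + L
    s+r<s+L = +-monoʳ-< s (m%n<n (a₁ ∸ s) L)
    s+r≤b : s + r ≤ b
    s+r≤b = ≤-trans (within (<⇒≤ s+r<s+L)) big≤b
    a₁≈s+r : a₁ ≈ s + r
    a₁≈s+r = 0 , (a₁ ∸ s) / L , (begin
      a₁ + 0 * L                  ≡⟨ +-identityʳ a₁ ⟩
      a₁                          ≡⟨ sym (m+[n∸m]≡n (≮⇒≥ a₁≮s)) ⟩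
      s + (a₁ ∸ s)                ≡⟨ cong (s +_) (m≡m%n+[m/n]*n (a₁ ∸ s) L) ⟩
      s + (r + (a₁ ∸ s) / L * L)  ≡⟨ sym (+-assoc s r _) ⟩
      s + r + (a₁ ∸ s) / L * L    ∎)
      where open ≡-Reasoning

-- Decidable equality of pairs, deciding componentwise: `does` of a pair
-- comparison computes to the conjunction of the component decisions.
_×-≟_ : {A B : Set} → DecidableEquality A → DecidableEquality B → DecidableEquality (A × B)
(_≟₁_ ×-≟ _≟₂_) (a , b) (a′ , b′) =
  map′ (λ (p , q) → cong₂ _,_ p q) (λ { refl → refl , refl }) (a ≟₁ a′ ×-dec b ≟₂ b′)

_≟ᵛ_ : ∀ {j} → DecidableEquality (Vec Bool j)
_≟ᵛ_ = Vec.≡-dec _≟ᵇ_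

≟ᵛ-∷ : ∀ {j} (v : Vec Bool (suc j)) b u →
       does (v ≟ᵛ (b ∷ u)) ≡ does (head v ≟ᵇ b) ∧ does (tail v ≟ᵛ u)
≟ᵛ-∷ (x ∷ xs) b u = refl

≟ᵛ-[] : (v : Vec Bool 0) → does (v ≟ᵛ []) ≡ true
≟ᵛ-[] [] = refl

-- A listing of a type with decidable equality: a finite family in which
-- every element occurs exactly once.  Colour types are listed so that sums
-- over rows can be regrouped by colour.
record Listing {C : Set} (_≟_ : DecidableEquality C) : Set where
  field
    length  : ℕ
    element : Fin length → C
    once    : ∀ x → count (λ i → does (x ≟ element i)) ≡ 1

bool-listing : Listing _≟ᵇ_
bool-listing = record
  { length = 2 ; element = elements ; once = λ { true → refl ; false → refl } }
  where
  elements : Fin 2 → Bool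
  elements zero       = false
  elements (suc zero) = true

×-listing : {A B : Set} {_≟₁_ : DecidableEquality A} {_≟₂_ : DecidableEquality B} →
            Listing _≟₁_ → Listing _≟₂_ → Listing (_≟₁_ ×-≟ _≟₂_)
×-listing {A} {B} {_≟₁_} {_≟₂_} N₁ N₂ = record
  { length = n₁ * n₂ ; element = elements ; once = once-pair }
  where
  open Listing N₁ renaming (length to n₁; element to e₁; once to once₁)
  open Listing N₂ renaming (length to n₂; element to e₂; once to once₂)

  pair : Fin n₁ × Fin n₂ → A × B
  pair (x , y) = e₁ x , e₂ y

  elements : Fin (n₁ * n₂) → A × B
  elements i = pair (remQuot n₂ i)

  once-pair : ∀ ab → count (λ i → does ((_≟₁_ ×-≟ _≟₂_) ab (elements i))) ≡ 1
  once-pair (a , b) = trans (sum-combine n₁ hit) (trans (sum-cong-≗ row) (once₁ a))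
    where
    hit : Fin (n₁ * n₂) → ℕ
    hit i = 𝟙 (does ((_≟₁_ ×-≟ _≟₂_) (a , b) (elements i)))

    row : ∀ x → sum (λ y → hit (combine x y)) ≡ 𝟙 (does (a ≟₁ e₁ x))
    row x = begin
      sum (λ y → hit (combine x y))
        ≡⟨ sum-cong-≗ (λ y → cong (λ xy → 𝟙 (does ((_≟₁_ ×-≟ _≟₂_) (a , b) (pair xy))))
                                  (remQuot-combine x y)) ⟩
      sum (λ y → 𝟙 (does (a ≟₁ e₁ x) ∧ does (b ≟₂ e₂ y)))
        ≡⟨ sum-cong-≗ (λ y → 𝟙-∧ (does (a ≟₁ e₁ x)) (does (b ≟₂ e₂ y))) ⟩
      sum (λ y → 𝟙 (does (a ≟₁ e₁ x)) * 𝟙 (does (b ≟₂ e₂ y)))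
        ≡⟨ sym (*-distribˡ-sum (𝟙 (does (a ≟₁ e₁ x))) (λ y → 𝟙 (does (b ≟₂ e₂ y)))) ⟩
      𝟙 (does (a ≟₁ e₁ x)) * count (λ y → does (b ≟₂ e₂ y))
        ≡⟨ cong (𝟙 (does (a ≟₁ e₁ x)) *_) (once₂ b) ⟩
      𝟙 (does (a ≟₁ e₁ x)) * 1
        ≡⟨ *-identityʳ _ ⟩
      𝟙 (does (a ≟₁ e₁ x)) ∎
      where open ≡-Reasoning

vec-listing : {A : Set} {_≟_ : DecidableEquality A} →
              Listing _≟_ → ∀ n → Listing (Vec.≡-dec {n = n} _≟_)
vec-listing N zero    = record { length = 1 ; element = λ _ → [] ; once = λ { [] → refl } }
vec-listing N (suc n) = record
  { length  = length
  ; element = λ i → proj₁ (element i) ∷ proj₂ (element i)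
  ; once    = λ { (x ∷ xs) → once (x , xs) } }
  where open Listing (×-listing N (vec-listing N n))

sum-by-colour : {C : Set} {_≟_ : DecidableEquality C} (N : Listing _≟_) (g : C → ℕ) (κ : Fin ℓ → C) →
                let open Listing N in
                sum (λ y → g (κ y)) ≡ sum (λ i → g (element i) * count (λ y → does (κ y ≟ element i)))
sum-by-colour {_≟_ = _≟_} N g κ = begin
  sum (λ y → g (κ y))
    ≡⟨ sum-cong-≗ (λ y → sym (trans (cong (g (κ y) *_) (once (κ y))) (*-identityʳ (g (κ y))))) ⟩
  sum (λ y → g (κ y) * count (λ i → does (κ y ≟ e i)))
    ≡⟨ sum-cong-≗ (λ y → *-distribˡ-sum (g (κ y)) (λ i → 𝟙 (does (κ y ≟ e i)))) ⟩
  sum (λ y → sum (λ i → g (κ y) * 𝟙 (does (κ y ≟ e i))))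
    ≡⟨ sum-cong-≗ (λ y → sum-cong-≗ (λ i → pick (κ y) (e i))) ⟩
  sum (λ y → sum (λ i → g (e i) * 𝟙 (does (κ y ≟ e i))))
    ≡⟨ ∑-comm (λ y i → g (e i) * 𝟙 (does (κ y ≟ e i))) ⟩
  sum (λ i → sum (λ y → g (e i) * 𝟙 (does (κ y ≟ e i))))
    ≡⟨ sum-cong-≗ (λ i → sym (*-distribˡ-sum (g (e i)) (λ y → 𝟙 (does (κ y ≟ e i))))) ⟩
  sum (λ i → g (e i) * count (λ y → does (κ y ≟ e i))) ∎
  where
  open ≡-Reasoning
  open Listing N renaming (element to e)
  pick : ∀ x c → g x * 𝟙 (does (x ≟ c)) ≡ g c * 𝟙 (does (x ≟ c))
  pick x c with x ≟ c
  ... | yes refl = refl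
  ... | no _     = trans (*-zeroʳ (g x)) (sym (*-zeroʳ (g c)))

-- A palette: the colours a row can carry, with decidable equality, and the
-- pinned colours (those of rows holding an interpreted point), whose
-- numbers of rows have to agree exactly rather than up to a threshold.
record Palette : Set₁ where
  field
    Colour : Set
    _≟_    : DecidableEquality Colour
    pinned : Colour → Bool
open Palette

infixr 5 _⊗_
_⊗_ : {A : Set} → DecidableEquality A → Palette → Palette
_⊗_ {A} _≟ᴬ_ P = record
  { Colour = A × Colour P ; _≟_ = _≟ᴬ_ ×-≟ _≟_ P ; pinned = λ ac → pinned P (proj₂ ac) }

rows : (P : Palette) → (Fin ℓ → Colour P) → Colour P → ℕ
rows P κ c = count (λ y → does (_≟_ P (κ y) c))

marked : (P : Palette) → (Fin ℓ → Bool) → (Fin ℓ → Colour P) → Colour P → ℕ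
marked P h κ c = count (λ y → h y ∧ does (_≟_ P (κ y) c))

marked≤rows : (P : Palette) (h : Fin ℓ → Bool) (κ : Fin ℓ → Colour P) (c : Colour P) →
              marked P h κ c ≤ rows P κ c
marked≤rows P h κ c =
  ≤-trans (m≤m+n (marked P h κ c) _) (≤-reflexive (sym (count-split (λ y → does (_≟_ P (κ y) c)) h)))

rows-marked : (P : Palette) (h : Fin ℓ → Bool) (κ : Fin ℓ → Colour P) (c : Colour P) →
              rows (_≟ᵇ_ ⊗ P) (λ y → h y , κ y) (true , c) ≡ marked P h κ c
rows-marked P h κ c = count-cong (λ y → cong (_∧ does (_≟_ P (κ y) c)) (≟-true (h y)))
  where
  ≟-true : ∀ b → does (b ≟ᵇ true) ≡ b
  ≟-true true  = refl
  ≟-true false = refl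

rows-unmarked : (P : Palette) (h : Fin ℓ → Bool) (κ : Fin ℓ → Colour P) (c : Colour P) →
                rows (_≟ᵇ_ ⊗ P) (λ y → h y , κ y) (false , c) ≡ rows P κ c ∸ marked P h κ c
rows-unmarked P h κ c = begin
  rows (_≟ᵇ_ ⊗ P) (λ y → h y , κ y) (false , c) ≡⟨ count-cong (λ y → cong (_∧ has-c y) (≟-false (h y))) ⟩
  count unmarked                                ≡⟨ m+n∸m≡n (marked P h κ c) (count unmarked) ⟨
  marked P h κ c + count unmarked ∸ marked P h κ c ≡⟨ cong (_∸ marked P h κ c) (count-split has-c h) ⟨
  rows P κ c ∸ marked P h κ c                   ∎
  where
  open ≡-Reasoning
  has-c : Fin _ → Bool
  has-c y = does (_≟_ P (κ y) c)
  unmarked : Fin _ → Bool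
  unmarked y = not (h y) ∧ has-c y
  ≟-false : ∀ b → does (b ≟ᵇ false) ≡ not b
  ≟-false true  = refl
  ≟-false false = refl

select : (P : Palette) → (Colour P → ℕ) → (Fin ℓ → Colour P) → Fin ℓ → Bool
select P n κ zero    = 0 <ᵇ n (κ zero)
select P n κ (suc y) = select P (λ c → n c ∸ 𝟙 (does (_≟_ P (κ zero) c))) (λ i → κ (suc i)) y

marked-select : (P : Palette) (n : Colour P → ℕ) (κ : Fin ℓ → Colour P) (c : Colour P) →
                marked P (select P n κ) κ c ≡ n c ⊓ rows P κ c
marked-select {zero}  P n κ c = sym (⊓-zeroʳ (n c))
marked-select {suc ℓ} P n κ c =
  trans (cong (𝟙 ((0 <ᵇ n (κ zero)) ∧ does (_≟_ P (κ zero) c)) +_)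
              (marked-select P n′ (λ i → κ (suc i)) c))
        (first-row (_≟_ P (κ zero) c))
  where
  n′ : Colour P → ℕ
  n′ c′ = n c′ ∸ 𝟙 (does (_≟_ P (κ zero) c′))
  r : ℕ
  r = rows P (λ i → κ (suc i)) c
  first-row : (d : Dec (κ zero ≡ c)) →
              𝟙 ((0 <ᵇ n (κ zero)) ∧ does d) + (n c ∸ 𝟙 (does d)) ⊓ r ≡ n c ⊓ (𝟙 (does d) + r)
  first-row (yes κ₀≡c) =
    trans (cong (λ c′ → 𝟙 ((0 <ᵇ n c′) ∧ true) + (n c ∸ 1) ⊓ r) κ₀≡c) (take-one (n c))
    where
    take-one : ∀ m → 𝟙 ((0 <ᵇ m) ∧ true) + (m ∸ 1) ⊓ r ≡ m ⊓ suc r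
    take-one zero    = refl
    take-one (suc m) = refl
  first-row (no _) = cong (λ b → 𝟙 b + n c ⊓ r) (∧-zeroʳ (0 <ᵇ n (κ zero)))

module Similarity (L : ℕ) where
  open Congruence L
  open Threshold L

  record SimilarAt (P : Palette) (t : ℕ) (κA : Fin ℓA → Colour P) (κB : Fin ℓB → Colour P)
                   (c : Colour P) : Set where
    field
      exactly   : pinned P c ≡ true → rows P κA c ≡ rows P κB c
      roughly   : rows P κA c ≈[ t ] rows P κB c
  open SimilarAt public

  Similar : (P : Palette) → ℕ → (Fin ℓA → Colour P) → (Fin ℓB → Colour P) → Set
  Similar P t κA κB = ∀ c → SimilarAt P t κA κB c

  Similar-sym : {P : Palette} {κA : Fin ℓA → Colour P} {κB : Fin ℓB → Colour P} →
                Similar P t κA κB → Similar P t κB κA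
  Similar-sym sim c = record
    { exactly = λ pinned → sym (exactly (sim c) pinned) ; roughly = ≈[]-sym (roughly (sim c)) }

  recolour : (P P′ : Palette) (f : Colour P′ → Colour P)
             {κA : Fin ℓA → Colour P} {κB : Fin ℓB → Colour P}
             {κA′ : Fin ℓA → Colour P′} {κB′ : Fin ℓB → Colour P′} →
             (∀ c′ → pinned P′ c′ ≡ pinned P (f c′)) →
             (∀ c′ → rows P′ κA′ c′ ≡ rows P κA (f c′)) →
             (∀ c′ → rows P′ κB′ c′ ≡ rows P κB (f c′)) →
             Similar P t κA κB → Similar P′ t κA′ κB′
  recolour P P′ f pin≡ rowsA≡ rowsB≡ sim c′ = record
    { exactly = λ pinned →
        trans (rowsA≡ c′) (trans (exactly (sim (f c′)) (trans (sym (pin≡ c′)) pinned)) (sym (rowsB≡ c′)))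
    ; roughly = subst₂ _≈[ _ ]_ (sym (rowsA≡ c′)) (sym (rowsB≡ c′)) (roughly (sim (f c′))) }

  weighted-sum-≈ : (P : Palette) (N : Listing (_≟_ P)) (g : Colour P → ℕ)
                   {κA : Fin ℓA → Colour P} {κB : Fin ℓB → Colour P} →
                   Similar P t κA κB → sum (λ y → g (κA y)) ≈ sum (λ y → g (κB y))
  weighted-sum-≈ P N g {κA} {κB} sim =
    subst₂ _≈_ (sym (sum-by-colour N g κA)) (sym (sum-by-colour N g κB))
      (sum-cong (λ i → *-congˡ (g (element i)) (≈[]⇒≈ (roughly (sim (element i))))))
    where open Listing N

  refine-by-bit : .{{NonZero L}} → (P : Palette) (s : ℕ)
                  (κA : Fin ℓA → Colour P) (κB : Fin ℓB → Colour P) →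
                  Similar P (s + s + L) κA κB → (hA : Fin ℓA → Bool) →
                  Σ (Fin ℓB → Bool) λ hB →
                    Similar (_≟ᵇ_ ⊗ P) s (λ y → hA y , κA y) (λ y → hB y , κB y)
  refine-by-bit {ℓB = ℓB} P s κA κB sim hA = hB , similar
    where
    open MatchingPart

    matching : ∀ c → MatchingPart s (rows P κA c) (rows P κB c) (marked P hA κA c)
    matching c = split s (marked≤rows P hA κA c) (roughly (sim c))

    -- Mark in B, within each colour class, as many rows as the matching part.
    hB : Fin ℓB → Bool
    hB = select P (λ c → part (matching c)) κB

    marked-part : ∀ c → marked P hB κB c ≡ part (matching c)
    marked-part c = trans (marked-select P _ κB c) (m≤n⇒m⊓n≡m (part≤ (matching c)))

    markedB : ∀ c → rows (_≟ᵇ_ ⊗ P) (λ y → hB y , κB y) (true , c) ≡ part (matching c)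
    markedB c = trans (rows-marked P hB κB c) (marked-part c)

    unmarkedB : ∀ c → rows (_≟ᵇ_ ⊗ P) (λ y → hB y , κB y) (false , c) ≡ rows P κB c ∸ part (matching c)
    unmarkedB c = trans (rows-unmarked P hB κB c) (cong (rows P κB c ∸_) (marked-part c))

    similar : Similar (_≟ᵇ_ ⊗ P) s (λ y → hA y , κA y) (λ y → hB y , κB y)
    similar (true , c) = record
      { exactly = λ pinned → trans (rows-marked P hA κA c)
                               (trans (exact (matching c) (exactly (sim c) pinned)) (sym (markedB c)))
      ; roughly = subst₂ _≈[ s ]_ (sym (rows-marked P hA κA c)) (sym (markedB c)) (parts (matching c)) }
    similar (false , c) = record
      { exactly = λ pinned → trans (rows-unmarked P hA κA c)
                               (trans (cong₂ _∸_ (exactly (sim c) pinned) (exact (matching c) (exactly (sim c) pinned)))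
                                      (sym (unmarkedB c)))
      ; roughly = subst₂ _≈[ s ]_ (sym (rows-unmarked P hA κA c)) (sym (unmarkedB c)) (complements (matching c)) }

  partner-row : {P : Palette} {κA : Fin ℓA → Colour P} {κB : Fin ℓB → Colour P} →
                Similar P t κA κB → (y : Fin ℓA) → pinned P (κA y) ≡ true ⊎ 1 ≤ t →
                Σ (Fin ℓB) λ y′ → κB y′ ≡ κA y
  partner-row {P = P} {κA} {κB} sim y pinned⊎1≤t =
    let (y′ , hit) = count-witness (λ z → does (_≟_ P (κB z) cy)) 1≤rowsB
    in y′ , does⇒witness (_≟_ P (κB y′) cy) hit
    where
    cy : Colour P
    cy = κA y
    1≤rowsA : 1 ≤ rows P κA cy
    1≤rowsA = count-nonzero (λ z → does (_≟_ P (κA z) cy)) y (dec-true (_≟_ P cy cy) refl)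
    1≤rowsB : 1 ≤ rows P κB cy
    1≤rowsB = [ (λ pinned-cy → ≤-trans 1≤rowsA (≤-reflexive (exactly (sim cy) pinned-cy)))
              , (λ 1≤t → ≈[]-nonzero 1≤t (roughly (sim cy)) 1≤rowsA) ]′ pinned⊎1≤t

  -- The threshold needed so that j refinements by one bit leave threshold t.
  cost : ℕ → ℕ → ℕ
  cost zero    t = t
  cost (suc j) t = cost j (t + t + L)

  cost-inflationary : ∀ j t → t ≤ cost j t
  cost-inflationary zero    t = ≤-refl
  cost-inflationary (suc j) t =
    ≤-trans (≤-trans (m≤m+n t t) (m≤m+n (t + t) L)) (cost-inflationary j (t + t + L))

  cost-grows : .{{NonZero L}} → ∀ j t → 1 ≤ j → suc t ≤ cost j t
  cost-grows (suc j) t _ = ≤-trans t+1≤2t+L (cost-inflationary j (t + t + L))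
    where
    t+1≤2t+L : suc t ≤ t + t + L
    t+1≤2t+L = ≤-trans (≤-trans (≤-reflexive (+-comm 1 t)) (+-monoʳ-≤ t (>-nonZero⁻¹ L)))
                       (≤-trans (m≤n+m (t + L) t) (≤-reflexive (sym (+-assoc t t L))))

  -- Closed form: each refinement doubles t + L.
  cost-closed : ∀ j t → cost j t + L ≡ 2 ^ j * (t + L)
  cost-closed zero    t = sym (*-identityˡ (t + L))
  cost-closed (suc j) t = begin
    cost j (t + t + L) + L    ≡⟨ cost-closed j (t + t + L) ⟩
    2 ^ j * (t + t + L + L)   ≡⟨ cong (2 ^ j *_) (double t L) ⟩
    2 ^ j * (2 * (t + L))     ≡⟨ x∙yz≈y∙xz (2 ^ j) 2 (t + L) ⟩
    2 * (2 ^ j * (t + L))     ≡⟨ sym (*-assoc 2 (2 ^ j) (t + L)) ⟩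
    2 ^ suc j * (t + L)       ∎
    where
    open ≡-Reasoning
    double : ∀ t L → t + t + L + L ≡ 2 * (t + L)
    double = solve-∀

  refine-by-bits : .{{NonZero L}} → (j : ℕ) (P : Palette) (t : ℕ)
                   (κA : Fin ℓA → Colour P) (κB : Fin ℓB → Colour P) →
                   Similar P (cost j t) κA κB → (dA : Fin ℓA → Vec Bool j) →
                   Σ (Fin ℓB → Vec Bool j) λ dB →
                     Similar (_≟ᵛ_ ⊗ P) t (λ y → dA y , κA y) (λ y → dB y , κB y)
  refine-by-bits zero P t κA κB sim dA =
    (λ _ → []) , recolour P (_≟ᵛ_ ⊗ P) proj₂ (λ _ → refl) rowsA (λ { ([] , c) → refl }) sim
    where
    rowsA : ∀ c′ → rows (_≟ᵛ_ ⊗ P) (λ y → dA y , κA y) c′ ≡ rows P κA (proj₂ c′)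
    rowsA ([] , c) = count-cong (λ y → cong (_∧ does (_≟_ P (κA y) c)) (≟ᵛ-[] (dA y)))
  refine-by-bits (suc j) P t κA κB sim dA
    with refine-by-bits j P (t + t + L) κA κB sim (λ y → tail (dA y))
  ... | tB , similar-tails
    with refine-by-bit (_≟ᵛ_ ⊗ P) t (λ y → tail (dA y) , κA y) (λ y → tB y , κB y) similar-tails
                       (λ y → head (dA y))
  ... | hB , similar-heads = (λ y → hB y ∷ tB y) ,
    recolour (_≟ᵇ_ ⊗ _≟ᵛ_ ⊗ P) (_≟ᵛ_ ⊗ P) uncons (λ { (_ ∷ _ , _) → refl })
             rowsA rowsB similar-heads
    where
    uncons : Vec Bool (suc j) × Colour P → Bool × Vec Bool j × Colour P
    uncons (b ∷ u , c) = b , u , c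
    rowsA : ∀ c′ → rows (_≟ᵛ_ ⊗ P) (λ y → dA y , κA y) c′ ≡
                   rows (_≟ᵇ_ ⊗ _≟ᵛ_ ⊗ P) (λ y → head (dA y) , tail (dA y) , κA y) (uncons c′)
    rowsA (b ∷ u , c) = count-cong λ y →
      trans (cong (_∧ does (_≟_ P (κA y) c)) (≟ᵛ-∷ (dA y) b u))
            (∧-assoc (does (head (dA y) ≟ᵇ b)) (does (tail (dA y) ≟ᵛ u)) (does (_≟_ P (κA y) c)))
    rowsB : ∀ c′ → rows (_≟ᵛ_ ⊗ P) (λ y → hB y ∷ tB y , κB y) c′ ≡
                   rows (_≟ᵇ_ ⊗ _≟ᵛ_ ⊗ P) (λ y → hB y , tB y , κB y) (uncons c′)
    rowsB (b ∷ u , c) = count-cong λ y →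
      ∧-assoc (does (hB y ≟ᵇ b)) (does (tB y ≟ᵛ u)) (does (_≟_ P (κB y) c))

module GridGeometry (k : ℕ) where

  cell : Fin k → Fin ℓ → Fin (k * ℓ)
  cell = combine

  column : Fin (k * ℓ) → Fin k
  column {ℓ} i = proj₁ (remQuot {k} ℓ i)

  row : Fin (k * ℓ) → Fin ℓ
  row {ℓ} i = proj₂ (remQuot {k} ℓ i)

  cell-column-row : (i : Fin (k * ℓ)) → cell (column i) (row i) ≡ i
  cell-column-row {ℓ} i = combine-remQuot {k} ℓ i

  column-cell : (x : Fin k) (y : Fin ℓ) → column (cell x y) ≡ x
  column-cell x y = cong proj₁ (remQuot-combine x y)

  row-cell : (x : Fin k) (y : Fin ℓ) → row (cell x y) ≡ y
  row-cell x y = cong proj₂ (remQuot-combine x y)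

  ≟-cell : (x x′ : Fin k) (y y′ : Fin ℓ) →
           does (cell x y ≟ᶠ cell x′ y′) ≡ does (x ≟ᶠ x′) ∧ does (y ≟ᶠ y′)
  ≟-cell x x′ y y′ with x ≟ᶠ x′ | y ≟ᶠ y′
  ... | yes refl | yes refl = dec-true (cell x y ≟ᶠ cell x y) refl
  ... | yes refl | no y≢y′  = dec-false (cell x y ≟ᶠ cell x y′) λ e →
    y≢y′ (trans (sym (row-cell x y)) (trans (cong row e) (row-cell x y′)))
  ... | no x≢x′  | _        = dec-false (cell x y ≟ᶠ cell x′ y′) λ e →
    x≢x′ (trans (sym (column-cell x y)) (trans (cong column e) (column-cell x′ y′)))

  ∣∣-by-rows : (X : Subset (k * ℓ)) → ∣ X ∣ₛ ≡ sum (λ y → count (λ x → lookup X (cell x y)))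
  ∣∣-by-rows {ℓ} X =
    trans (∣∣-count X) (trans (sum-combine k (λ i → 𝟙 (lookup X i))) (∑-comm (λ x y → 𝟙 (lookup X (cell x y)))))
    where
    ∣∣-count : ∀ {n} (S : Subset n) → ∣ S ∣ₛ ≡ count (lookup S)
    ∣∣-count []          = refl
    ∣∣-count (true ∷ S)  = cong suc (∣∣-count S)
    ∣∣-count (false ∷ S) = ∣∣-count S

-- Colouring the rows of a grid by an assignment of p points and q sets:
-- row y records, for each point variable and each set variable, which of
-- its k cells the point occupies or the set contains.
module RowColours (k : ℕ) where
  open GridGeometry k

  GridColour : ℕ → ℕ → Set
  GridColour p q = Vec (Vec Bool k) p × Vec (Vec Bool k) q

  any : ∀ {n} → Vec Bool n → Bool
  any []      = false
  any (b ∷ u) = b ∨ any u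

  occupied : ∀ {p} → Vec (Vec Bool k) p → Bool
  occupied []      = false
  occupied (u ∷ P) = any u ∨ occupied P

  _≟ᵗ_ : ∀ {n} → DecidableEquality (Vec (Vec Bool k) n)
  _≟ᵗ_ = Vec.≡-dec _≟ᵛ_

  GridPalette : ℕ → ℕ → Palette
  GridPalette p q = record
    { Colour = GridColour p q ; _≟_ = _≟ᵗ_ ×-≟ _≟ᵗ_ ; pinned = λ c → occupied (proj₁ c) }

  grid-listing : ∀ p q → Listing (_≟_ (GridPalette p q))
  grid-listing p q = ×-listing (vec-listing bits p) (vec-listing bits q)
    where
    bits : Listing (_≟ᵛ_ {k})
    bits = vec-listing bool-listing k

  pointTrace : ∀ {p} → (Fin p → Fin (k * ℓ)) → Fin ℓ → Vec (Vec Bool k) p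
  pointTrace ρ y = tabulate (λ i → tabulate (λ x → does (ρ i ≟ᶠ cell x y)))

  setTrace : ∀ {q} → (Fin q → Subset (k * ℓ)) → Fin ℓ → Vec (Vec Bool k) q
  setTrace σ y = tabulate (λ j → tabulate (λ x → lookup (σ j) (cell x y)))

  colour : ∀ {p q} → (Fin p → Fin (k * ℓ)) → (Fin q → Subset (k * ℓ)) → Fin ℓ → GridColour p q
  colour ρ σ y = pointTrace ρ y , setTrace σ y

  pointTrace-bit : ∀ {p} (ρ : Fin p → Fin (k * ℓ)) y i x →
                   lookup (lookup (pointTrace ρ y) i) x ≡ does (ρ i ≟ᶠ cell x y)
  pointTrace-bit ρ y i x = trans (cong (λ v → lookup v x) (Vec.lookup∘tabulate _ i)) (Vec.lookup∘tabulate _ x)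

  setTrace-bit : ∀ {q} (σ : Fin q → Subset (k * ℓ)) y j x →
                 lookup (lookup (setTrace σ y) j) x ≡ lookup (σ j) (cell x y)
  setTrace-bit σ y j x = trans (cong (λ v → lookup v x) (Vec.lookup∘tabulate _ j)) (Vec.lookup∘tabulate _ x)

  occupied-row : ∀ {p} (ρ : Fin p → Fin (k * ℓ)) i → occupied (pointTrace ρ (row (ρ i))) ≡ true
  occupied-row ρ i = occupied-bit (pointTrace ρ (row (ρ i))) i (column (ρ i))
    (trans (pointTrace-bit ρ (row (ρ i)) i (column (ρ i))) (dec-true (ρ i ≟ᶠ _) (sym (cell-column-row (ρ i)))))
    where
    any-bit : ∀ {n} (u : Vec Bool n) x → lookup u x ≡ true → any u ≡ true
    any-bit (true ∷ u)  zero    _   = refl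
    any-bit (b ∷ u)     (suc x) ux with b
    ... | true  = refl
    ... | false = any-bit u x ux
    occupied-bit : ∀ {p} (P : Vec (Vec Bool k) p) i x → lookup (lookup P i) x ≡ true → occupied P ≡ true
    occupied-bit (u ∷ P) zero    x ux rewrite any-bit u x ux = refl
    occupied-bit (u ∷ P) (suc i) x Pix with any u
    ... | true  = refl
    ... | false = occupied-bit P i x Pix

  same-colour-point : ∀ {p q ℓA ℓB} {ρA : Fin p → Fin (k * ℓA)} {σA : Fin q → Subset (k * ℓA)}
                      {ρB : Fin p → Fin (k * ℓB)} {σB : Fin q → Subset (k * ℓB)} {y y′} →
                      colour ρB σB y′ ≡ colour ρA σA y → ∀ j x → ρA j ≡ cell x y → ρB j ≡ cell x y′
  same-colour-point {ρA = ρA} {σA} {ρB} {σB} {y} {y′} same j x ρAj≡ =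
    does⇒witness (ρB j ≟ᶠ cell x y′) (begin
      does (ρB j ≟ᶠ cell x y′)                          ≡⟨ sym (pointTrace-bit ρB y′ j x) ⟩
      lookup (lookup (pointTrace ρB y′) j) x          ≡⟨ cong (λ c → lookup (lookup (proj₁ c) j) x) same ⟩
      lookup (lookup (pointTrace ρA y) j) x           ≡⟨ pointTrace-bit ρA y j x ⟩
      does (ρA j ≟ᶠ cell x y)                          ≡⟨ dec-true (ρA j ≟ᶠ cell x y) ρAj≡ ⟩
      true                                            ∎)
    where open ≡-Reasoning

  same-colour-set : ∀ {p q ℓA ℓB} {ρA : Fin p → Fin (k * ℓA)} {σA : Fin q → Subset (k * ℓA)}
                    {ρB : Fin p → Fin (k * ℓB)} {σB : Fin q → Subset (k * ℓB)} {y y′} →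
                    colour ρB σB y′ ≡ colour ρA σA y → ∀ j x → lookup (σB j) (cell x y′) ≡ lookup (σA j) (cell x y)
  same-colour-set {ρA = ρA} {σA} {ρB} {σB} {y} {y′} same j x =
    trans (sym (setTrace-bit σB y′ j x))
          (trans (cong (λ c → lookup (lookup (proj₂ c) j) x) same) (setTrace-bit σA y j x))

-- This is the invariant of the back-and-forth argument; it
-- yields the atomic formulas and survives the choice of a point or a set.
module Correspondence (k L : ℕ) where
  open GridGeometry k
  open RowColours k
  open Congruence L
  open Threshold L
  open Similarity L

  record Corresponds {p q} (t : ℕ) (ρA : Fin p → Fin (k * ℓA)) (σA : Fin q → Subset (k * ℓA))
                     (ρB : Fin p → Fin (k * ℓB)) (σB : Fin q → Subset (k * ℓB)) : Set where
    constructor corresponds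
    field similar : Similar (GridPalette p q) t (colour ρA σA) (colour ρB σB)
  open Corresponds

  Corresponds-sym : ∀ {t p q} {ρA : Fin p → Fin (k * ℓA)} {σA : Fin q → Subset (k * ℓA)}
                    {ρB : Fin p → Fin (k * ℓB)} {σB : Fin q → Subset (k * ℓB)} →
                    Corresponds t ρA σA ρB σB → Corresponds t ρB σB ρA σA
  Corresponds-sym corr = corresponds (Similar-sym (similar corr))

  -- Before any choice every row has the empty colour, so grids whose
  -- numbers of rows are threshold-equal correspond.
  initial : ∀ {t} → ℓA ≈[ t ] ℓB → Corresponds {ℓA} {ℓB} t empty empty empty empty
  initial {ℓA} {ℓB} ℓA≈ℓB = corresponds λ { ([] , []) → record
    { exactly = λ ()
    ; roughly = subst₂ _≈[ _ ]_ (sym (count-true ℓA)) (sym (count-true ℓB)) ℓA≈ℓB } }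

  -- Atomic formulas.  The row of each point of A is pinned, so it has a
  -- partner row in B of the same colour, which contains the image point in
  -- the same column.
  module Atoms {t p q} {ρA : Fin p → Fin (k * ℓA)} {σA : Fin q → Subset (k * ℓA)}
               {ρB : Fin p → Fin (k * ℓB)} {σB : Fin q → Subset (k * ℓB)}
               (corr : Corresponds t ρA σA ρB σB) where

    partner : Fin p → Fin ℓB
    partner i = proj₁ (partner-row (similar corr) (row (ρA i)) (inj₁ (occupied-row ρA i)))

    partner-colour : ∀ i → colour ρB σB (partner i) ≡ colour ρA σA (row (ρA i))
    partner-colour i = proj₂ (partner-row (similar corr) (row (ρA i)) (inj₁ (occupied-row ρA i)))

    image-in-row : ∀ i j x → ρA j ≡ cell x (row (ρA i)) → ρB j ≡ cell x (partner i)
    image-in-row i = same-colour-point {ρA = ρA} {σA} {ρB} {σB} (partner-colour i)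

    image : ∀ i → ρB i ≡ cell (column (ρA i)) (partner i)
    image i = image-in-row i i (column (ρA i)) (sym (cell-column-row (ρA i)))

    column-image : ∀ i → column (ρB i) ≡ column (ρA i)
    column-image i = trans (cong column (image i)) (column-cell _ _)

    preserves-eq : ∀ i j → ρA i ≡ ρA j → ρB i ≡ ρB j
    preserves-eq i j ρAi≡ρAj = trans (image i)
      (sym (image-in-row i j (column (ρA i)) (trans (sym ρAi≡ρAj) (sym (cell-column-row (ρA i))))))

    preserves-column : ∀ i j → column (ρA i) ≡ column (ρA j) → column (ρB i) ≡ column (ρB j)
    preserves-column i j same = trans (column-image i) (trans same (sym (column-image j)))

    preserves-row : ∀ i j → row (ρA i) ≡ row (ρA j) → row (ρB i) ≡ row (ρB j)
    preserves-row i j same =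
      trans (cong row (image i)) (trans (row-cell _ _) (sym (trans (cong row ρBj≡) (row-cell _ _))))
      where
      ρBj≡ : ρB j ≡ cell (column (ρA j)) (partner i)
      ρBj≡ = image-in-row i j (column (ρA j))
               (trans (sym (cell-column-row (ρA j))) (cong (cell (column (ρA j))) (sym same)))

    preserves-mem : ∀ i X → lookup (σA X) (ρA i) ≡ true → lookup (σB X) (ρB i) ≡ true
    preserves-mem i X ρAi∈X = begin
      lookup (σB X) (ρB i)                                  ≡⟨ cong (lookup (σB X)) (image i) ⟩
      lookup (σB X) (cell (column (ρA i)) (partner i))
        ≡⟨ same-colour-set {ρA = ρA} {σA} {ρB} {σB} (partner-colour i) X (column (ρA i)) ⟩
      lookup (σA X) (cell (column (ρA i)) (row (ρA i)))      ≡⟨ cong (lookup (σA X)) (cell-column-row (ρA i)) ⟩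
      lookup (σA X) (ρA i)                                  ≡⟨ ρAi∈X ⟩
      true                                                  ∎
      where open ≡-Reasoning

  -- Cardinality atoms: the size of a set is a weighted sum over the row
  -- colours, so corresponding sets have congruent sizes.
  weight : ∀ {p q} → Fin q → GridColour p q → ℕ
  weight X (_ , S) = count (lookup (lookup S X))

  ∣∣-by-colour : ∀ {p q} (ρ : Fin p → Fin (k * ℓ)) (σ : Fin q → Subset (k * ℓ)) X →
                 ∣ σ X ∣ₛ ≡ sum (λ y → weight X (colour ρ σ y))
  ∣∣-by-colour ρ σ X =
    trans (∣∣-by-rows (σ X)) (sum-cong-≗ (λ y → count-cong (λ x → sym (setTrace-bit σ y X x))))

  preserves-size : ∀ {t p q} {ρA : Fin p → Fin (k * ℓA)} {σA : Fin q → Subset (k * ℓA)}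
                   {ρB : Fin p → Fin (k * ℓB)} {σB : Fin q → Subset (k * ℓB)} →
                   Corresponds t ρA σA ρB σB → ∀ X → ∣ σA X ∣ₛ ≈ ∣ σB X ∣ₛ
  preserves-size {p = p} {q} {ρA} {σA} {ρB} {σB} corr X =
    subst₂ _≈_ (sym (∣∣-by-colour ρA σA X)) (sym (∣∣-by-colour ρB σB X))
      (weighted-sum-≈ (GridPalette p q) (grid-listing p q) (weight X) (similar corr))

  -- The point step.  A new point in column x of row y is seen from row z
  -- as its marker; the rows carrying the marker are exactly row y.
  marker : Fin k → Fin ℓ → Fin ℓ → Vec Bool k
  marker x y z = tabulate (λ x′ → does (x ≟ᶠ x′) ∧ does (y ≟ᶠ z))

  blank : Vec Bool k
  blank = tabulate (λ _ → false)

  any-blank : any blank ≡ false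
  any-blank = any-false k
    where
    any-false : ∀ n → any (tabulate {n = n} (λ _ → false)) ≡ false
    any-false zero    = refl
    any-false (suc n) = any-false n

  single : Fin k → Vec Bool k
  single x = tabulate (λ x′ → does (x ≟ᶠ x′))

  marker-diagonal : (x : Fin k) (y : Fin ℓ) → marker x y y ≡ single x
  marker-diagonal x y = Vec.tabulate-cong λ x′ →
    trans (cong (does (x ≟ᶠ x′) ∧_) (dec-true (y ≟ᶠ y) refl)) (∧-identityʳ (does (x ≟ᶠ x′)))

  marker-here : (x : Fin k) (y : Fin ℓ) → marker x y y ≢ blank
  marker-here x y here≡blank = true≢false (begin
    true                      ≡⟨ sym (dec-true (x ≟ᶠ x) refl) ⟩
    does (x ≟ᶠ x)              ≡⟨ sym (Vec.lookup∘tabulate (λ x′ → does (x ≟ᶠ x′)) x) ⟩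
    lookup (single x) x       ≡⟨ cong (λ v → lookup v x) (trans (sym (marker-diagonal x y)) here≡blank) ⟩
    lookup blank x            ≡⟨ Vec.lookup∘tabulate (λ _ → false) x ⟩
    false                     ∎)
    where
    open ≡-Reasoning
    true≢false : true ≢ false
    true≢false ()

  module MarkedClass (P : Palette) (κ : Fin ℓ → Colour P) (x : Fin k) (y : Fin ℓ) (c : Colour P) where

    has-colour : Fin ℓ → Bool
    has-colour z = does (_≟_ P (κ z) c)

    off-y : Fin ℓ → Bool
    off-y z = not (does (y ≟ᶠ z))

    in-class : Vec Bool k → Fin ℓ → Bool
    in-class u z = does (marker x y z ≟ᵛ u) ∧ has-colour z

    private
      -- Off row y the marker is blank.
      at-y : ∀ u → count (in-class u) ≡
                   𝟙 (in-class u y) + count (λ z → off-y z ∧ (does (blank ≟ᵛ u) ∧ has-colour z))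
      at-y u = trans (count-split (in-class u) (λ z → does (y ≟ᶠ z)))
                     (cong₂ _+_ (count-at y (in-class u)) (count-cong elsewhere))
        where
        elsewhere : ∀ z → off-y z ∧ in-class u z ≡ off-y z ∧ (does (blank ≟ᵛ u) ∧ has-colour z)
        elsewhere z with y ≟ᶠ z
        ... | yes _ = refl
        ... | no _  = cong (λ v → does (v ≟ᵛ u) ∧ has-colour z)
                           (Vec.tabulate-cong (λ x′ → ∧-zeroʳ (does (x ≟ᶠ x′))))

    without-marker : count (in-class blank) ≡ rows P κ c ∸ 𝟙 (has-colour y)
    without-marker = begin
      count (in-class blank)
        ≡⟨ at-y blank ⟩
      𝟙 (in-class blank y) + count (λ z → off-y z ∧ (does (blank ≟ᵛ blank) ∧ has-colour z))
        ≡⟨ cong₂ _+_ (cong (λ b → 𝟙 (b ∧ has-colour y)) (dec-false (marker x y y ≟ᵛ blank) (marker-here x y)))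
                     (count-cong (λ z → cong (λ b → off-y z ∧ (b ∧ has-colour z)) (dec-true (blank ≟ᵛ blank) refl))) ⟩
      count (λ z → off-y z ∧ has-colour z)
        ≡⟨ count-except y has-colour ⟩
      rows P κ c ∸ 𝟙 (has-colour y) ∎
      where open ≡-Reasoning

    with-some-marker : ∀ u → u ≢ blank → count (in-class u) ≡ 𝟙 (in-class u y)
    with-some-marker u u≢blank = begin
      count (in-class u)
        ≡⟨ at-y u ⟩
      𝟙 (in-class u y) + count (λ z → off-y z ∧ (does (blank ≟ᵛ u) ∧ has-colour z))
        ≡⟨ cong (𝟙 (in-class u y) +_) (trans (count-cong nowhere) (count-false ℓ)) ⟩
      𝟙 (in-class u y) + 0
        ≡⟨ +-identityʳ _ ⟩
      𝟙 (in-class u y) ∎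
      where
      open ≡-Reasoning
      nowhere : ∀ z → off-y z ∧ (does (blank ≟ᵛ u) ∧ has-colour z) ≡ false
      nowhere z = trans (cong (λ b → off-y z ∧ (b ∧ has-colour z)) (dec-false (blank ≟ᵛ u) (λ e → u≢blank (sym e))))
                        (∧-zeroʳ (off-y z))

  rows-extended : ∀ {p q} (ρ : Fin p → Fin (k * ℓ)) (σ : Fin q → Subset (k * ℓ)) (b : Fin (k * ℓ))
                  (x : Fin k) (y : Fin ℓ) → (∀ z → tabulate (λ x′ → does (b ≟ᶠ cell x′ z)) ≡ marker x y z) →
                  ∀ u P S → rows (GridPalette (suc p) q) (colour (extend ρ b) σ) (u ∷ P , S) ≡
                            count (MarkedClass.in-class (GridPalette p q) (colour ρ σ) x y (P , S) u)
  rows-extended ρ σ b x y markers u P S = count-cong λ z →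
    trans (cong (λ v → (does (v ≟ᵛ u) ∧ does (pointTrace ρ z ≟ᵗ P)) ∧ does (setTrace σ z ≟ᵗ S)) (markers z))
          (∧-assoc (does (marker x y z ≟ᵛ u)) (does (pointTrace ρ z ≟ᵗ P)) (does (setTrace σ z ≟ᵗ S)))

  -- A point a of A, in column x and row y, is answered by the point in
  -- column x of a partner row y′ of the same colour (which exists as the
  -- threshold is positive).  Classes without marker lose one row on each
  -- side, classes with a marker consist of the row of the new point at most.
  point-step : ∀ {t p q} {ρA : Fin p → Fin (k * ℓA)} {σA : Fin q → Subset (k * ℓA)}
               {ρB : Fin p → Fin (k * ℓB)} {σB : Fin q → Subset (k * ℓB)} →
               suc t′ ≤ t → Corresponds t ρA σA ρB σB → (a : Fin (k * ℓA)) →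
               Σ (Fin (k * ℓB)) λ a′ → Corresponds t′ (extend ρA a) σA (extend ρB a′) σB
  point-step {ℓA} {t′ = t′} {p = p} {q} {ρA} {σA} {ρB} {σB} st′≤t corr a
    with partner-row (similar corr) (row a) (inj₂ (≤-trans (s≤s z≤n) st′≤t))
  ... | y′ , same = cell x y′ , corresponds extended
    where
    x : Fin k
    x = column a
    y : Fin ℓA
    y = row a

    markersA : ∀ z → tabulate (λ x′ → does (a ≟ᶠ cell x′ z)) ≡ marker x y z
    markersA z = Vec.tabulate-cong λ x′ →
      trans (cong (λ w → does (w ≟ᶠ cell x′ z)) (sym (cell-column-row a))) (≟-cell x x′ y z)
    markersB : ∀ z → tabulate (λ x′ → does (cell x y′ ≟ᶠ cell x′ z)) ≡ marker x y′ z
    markersB z = Vec.tabulate-cong λ x′ → ≟-cell x x′ y′ z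

    module ClassA (c : GridColour p q) = MarkedClass (GridPalette p q) (colour ρA σA) x y c
    module ClassB (c : GridColour p q) = MarkedClass (GridPalette p q) (colour ρB σB) x y′ c

    extended : Similar (GridPalette (suc p) q) t′ (colour (extend ρA a) σA) (colour (extend ρB (cell x y′)) σB)
    extended (u ∷ P , S) with u ≟ᵛ blank
    ... | yes refl = record
      { exactly = λ pinned →
          trans rowsA (trans (cong (_∸ 𝟙 (ClassA.has-colour c₀ y)) (exactly (similar corr c₀) (unpin pinned)))
                             (sym rowsB))
      ; roughly = subst₂ _≈[ t′ ]_ (sym rowsA) (sym rowsB)
                    (≈[]-∸𝟙 st′≤t (roughly (similar corr c₀)) (ClassA.has-colour c₀ y)) }
      where
      c₀ : GridColour p q
      c₀ = P , S
      unpin : any blank ∨ occupied P ≡ true → occupied P ≡ true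
      unpin = trans (cong (_∨ occupied P) (sym any-blank))
      rowsA : rows (GridPalette (suc p) q) (colour (extend ρA a) σA) (blank ∷ P , S) ≡
              rows (GridPalette p q) (colour ρA σA) c₀ ∸ 𝟙 (ClassA.has-colour c₀ y)
      rowsA = trans (rows-extended ρA σA a x y markersA blank P S) (ClassA.without-marker c₀)
      rowsB : rows (GridPalette (suc p) q) (colour (extend ρB (cell x y′)) σB) (blank ∷ P , S) ≡
              rows (GridPalette p q) (colour ρB σB) c₀ ∸ 𝟙 (ClassA.has-colour c₀ y)
      rowsB = trans (rows-extended ρB σB (cell x y′) x y′ markersB blank P S)
                    (trans (ClassB.without-marker c₀)
                           (cong (λ c′ → rows (GridPalette p q) (colour ρB σB) c₀ ∸ 𝟙 (does (_≟_ (GridPalette p q) c′ c₀)))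
                                 same))
    ... | no u≢blank = record { exactly = λ _ → rowsA≡rowsB ; roughly = inj₁ rowsA≡rowsB }
      where
      c₀ : GridColour p q
      c₀ = P , S
      rowsA≡rowsB : rows (GridPalette (suc p) q) (colour (extend ρA a) σA) (u ∷ P , S) ≡
                    rows (GridPalette (suc p) q) (colour (extend ρB (cell x y′)) σB) (u ∷ P , S)
      rowsA≡rowsB = begin
        rows (GridPalette (suc p) q) (colour (extend ρA a) σA) (u ∷ P , S)
          ≡⟨ rows-extended ρA σA a x y markersA u P S ⟩
        count (ClassA.in-class c₀ u)
          ≡⟨ ClassA.with-some-marker c₀ u u≢blank ⟩
        𝟙 (does (marker x y y ≟ᵛ u) ∧ ClassA.has-colour c₀ y)
          ≡⟨ cong₂ (λ v c′ → 𝟙 (does (v ≟ᵛ u) ∧ does (_≟_ (GridPalette p q) c′ c₀)))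
                   (trans (marker-diagonal x y) (sym (marker-diagonal x y′))) (sym same) ⟩
        𝟙 (does (marker x y′ y′ ≟ᵛ u) ∧ ClassB.has-colour c₀ y′)
          ≡⟨ ClassB.with-some-marker c₀ u u≢blank ⟨
        count (ClassB.in-class c₀ u)
          ≡⟨ rows-extended ρB σB (cell x y′) x y′ markersB u P S ⟨
        rows (GridPalette (suc p) q) (colour (extend ρB (cell x y′)) σB) (u ∷ P , S) ∎
        where open ≡-Reasoning

  -- A set meets each row in a vector of k bits, its trace;
  -- refining the row colours by the traces (k bits at a time) yields a set
  -- of B whose traces give similar refined colourings.
  trace : Subset (k * ℓ) → Fin ℓ → Vec Bool k
  trace X z = tabulate (λ x → lookup X (cell x z))

  untrace : (Fin ℓ → Vec Bool k) → Subset (k * ℓ)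
  untrace d = tabulate (λ i → lookup (d (row i)) (column i))

  trace-untrace : (d : Fin ℓ → Vec Bool k) → ∀ z → trace (untrace d) z ≡ d z
  trace-untrace d z = trans (Vec.tabulate-cong λ x →
      trans (Vec.lookup∘tabulate (λ i → lookup (d (row i)) (column i)) (cell x z))
            (cong₂ (λ z′ x′ → lookup (d z′) x′) (row-cell x z) (column-cell x z)))
    (Vec.tabulate∘lookup (d z))

  set-step : ∀ {p q} {ρA : Fin p → Fin (k * ℓA)} {σA : Fin q → Subset (k * ℓA)}
             {ρB : Fin p → Fin (k * ℓB)} {σB : Fin q → Subset (k * ℓB)} → .{{NonZero L}} →
             Corresponds (cost k t′) ρA σA ρB σB → (X : Subset (k * ℓA)) →
             Σ (Subset (k * ℓB)) λ X′ → Corresponds t′ ρA (extend σA X) ρB (extend σB X′)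
  set-step {t′ = t′} {p} {q} {ρA} {σA} {ρB} {σB} corr X
    with refine-by-bits k (GridPalette p q) t′ (colour ρA σA) (colour ρB σB) (similar corr) (trace X)
  ... | dB , refined = untrace dB , corresponds
    (recolour (_≟ᵛ_ ⊗ GridPalette p q) (GridPalette p (suc q)) split-off (λ { (_ , _ ∷ _) → refl })
              rowsA rowsB refined)
    where
    split-off : GridColour p (suc q) → Vec Bool k × GridColour p q
    split-off (P , u ∷ S) = u , P , S
    swap-front : ∀ x y z → x ∧ (y ∧ z) ≡ y ∧ (x ∧ z)
    swap-front true  y z = refl
    swap-front false y z = sym (∧-zeroʳ y)
    rowsA : ∀ c → rows (GridPalette p (suc q)) (colour ρA (extend σA X)) c ≡
                  rows (_≟ᵛ_ ⊗ GridPalette p q) (λ z → trace X z , colour ρA σA z) (split-off c)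
    rowsA (P , u ∷ S) = count-cong λ z →
      swap-front (does (pointTrace ρA z ≟ᵗ P)) (does (trace X z ≟ᵛ u)) (does (setTrace σA z ≟ᵗ S))
    rowsB : ∀ c → rows (GridPalette p (suc q)) (colour ρB (extend σB (untrace dB))) c ≡
                  rows (_≟ᵛ_ ⊗ GridPalette p q) (λ z → dB z , colour ρB σB z) (split-off c)
    rowsB (P , u ∷ S) = count-cong λ z → trans
      (cong (λ v → does (pointTrace ρB z ≟ᵗ P) ∧ (does (v ≟ᵛ u) ∧ does (setTrace σB z ≟ᵗ S)))
            (trace-untrace dB z))
      (swap-front (does (pointTrace ρB z ≟ᵗ P)) (does (dB z ≟ᵛ u)) (does (setTrace σB z ≟ᵗ S)))

module BackAndForth (M : List ℕ) (k L : ℕ) .{{_ : NonZero L}} (1≤k : 1 ≤ k)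
                    (M∣L : ∀ {m} → m ∈ M → m ∣ L) where
  open GridGeometry k
  open RowColours k
  open Correspondence k L
  open Congruence L
  open Threshold L
  open Similarity L

  -- Each round consumes k refinements by one bit.
  threshold : ℕ → ℕ
  threshold zero    = 0
  threshold (suc n) = cost k (threshold n)

  preserves : ∀ n {p q} (φ : Formula M p q) → qr φ ≤ n →
              {ρA : Fin p → Fin (k * ℓA)} {σA : Fin q → Subset (k * ℓA)}
              {ρB : Fin p → Fin (k * ℓB)} {σB : Fin q → Subset (k * ℓB)} →
              Corresponds (threshold n) ρA σA ρB σB →
              Sat (grid k ℓA) φ ρA σA → Sat (grid k ℓB) φ ρB σB
  preserves n (eq i j)   _ corr = Atoms.preserves-eq corr i j
  preserves n (relH i j) _ corr = Atoms.preserves-column corr i j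
  preserves n (relV i j) _ corr = Atoms.preserves-row corr i j
  preserves n (mem i X)  _ {ρA} {σA} {ρB} {σB} corr i∈X =
    Vec.lookup⇒[]= (ρB i) (σB X) (Atoms.preserves-mem corr i X (Vec.[]=⇒lookup i∈X))
  preserves n (card m m∈M r _ X) _ corr = transfer-mod (M∣L m∈M) (preserves-size corr X)
  preserves n (neg φ) qr≤n corr ¬satA satB = ¬satA (preserves n φ qr≤n (Corresponds-sym corr) satB)
  preserves n (and φ ψ) qr≤n corr (satφ , satψ) =
    preserves n φ (≤-trans (max-left (qr φ) (qr ψ)) qr≤n) corr satφ ,
    preserves n ψ (≤-trans (max-right (qr φ) (qr ψ)) qr≤n) corr satψ
  preserves n (or φ ψ) qr≤n corr (inj₁ satφ) =
    inj₁ (preserves n φ (≤-trans (max-left (qr φ) (qr ψ)) qr≤n) corr satφ)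
  preserves n (or φ ψ) qr≤n corr (inj₂ satψ) =
    inj₂ (preserves n ψ (≤-trans (max-right (qr φ) (qr ψ)) qr≤n) corr satψ)
  preserves (suc n) (ex1 φ) (s≤s qr≤n) corr (a , sat)
    with point-step (cost-grows k (threshold n) 1≤k) corr a
  ... | a′ , corr′ = a′ , preserves n φ qr≤n corr′ sat
  preserves (suc n) (all1 φ) (s≤s qr≤n) corr sat a′
    with point-step (cost-grows k (threshold n) 1≤k) (Corresponds-sym corr) a′
  ... | a , corr′ = preserves n φ qr≤n (Corresponds-sym corr′) (sat a)
  preserves (suc n) (ex2 φ) (s≤s qr≤n) corr (X , sat)
    with set-step corr X
  ... | X′ , corr′ = X′ , preserves n φ qr≤n corr′ sat
  preserves (suc n) (all2 φ) (s≤s qr≤n) corr sat X′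
    with set-step (Corresponds-sym corr) X′
  ... | X , corr′ = preserves n φ qr≤n (Corresponds-sym corr′) (sat X)

  threshold-closed : ∀ n → threshold n + L ≡ 2 ^ (k * n) * L
  threshold-closed zero    = trans (sym (*-identityˡ L)) (cong (λ e → 2 ^ e * L) (sym (*-zeroʳ k)))
  threshold-closed (suc n) = begin
    cost k (threshold n) + L    ≡⟨ cost-closed k (threshold n) ⟩
    2 ^ k * (threshold n + L)   ≡⟨ cong (2 ^ k *_) (threshold-closed n) ⟩
    2 ^ k * (2 ^ (k * n) * L)   ≡⟨ sym (*-assoc (2 ^ k) (2 ^ (k * n)) L) ⟩
    2 ^ k * 2 ^ (k * n) * L     ≡⟨ cong (_* L) (sym (^-distribˡ-+-* 2 k (k * n))) ⟩
    2 ^ (k + k * n) * L         ≡⟨ cong (λ e → 2 ^ e * L) (sym (*-suc k n)) ⟩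
    2 ^ (k * suc n) * L         ∎
    where open ≡-Reasoning

  threshold-bound : ∀ n → (2 ^ (k * n + 1) ∸ 2) * L ≡ threshold n + threshold n
  threshold-bound n = begin
    (2 ^ (k * n + 1) ∸ 2) * L             ≡⟨ *-distribʳ-∸ L (2 ^ (k * n + 1)) 2 ⟩
    2 ^ (k * n + 1) * L ∸ 2 * L
      ≡⟨ cong (λ x → x * L ∸ 2 * L) (trans (^-distribˡ-+-* 2 (k * n) 1) (*-comm (2 ^ (k * n)) 2)) ⟩
    2 * 2 ^ (k * n) * L ∸ 2 * L
      ≡⟨ cong (_∸ 2 * L) (trans (*-assoc 2 (2 ^ (k * n)) L) (cong (2 *_) (sym (threshold-closed n)))) ⟩
    2 * (threshold n + L) ∸ 2 * L         ≡⟨ cong (_∸ 2 * L) (double (threshold n) L) ⟩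
    threshold n + threshold n + 2 * L ∸ 2 * L ≡⟨ m+n∸n≡m (threshold n + threshold n) (2 * L) ⟩
    threshold n + threshold n             ∎
    where
    open ≡-Reasoning
    double : ∀ t L → 2 * (t + L) ≡ t + t + 2 * L
    double = solve-∀

lcmL-nonZero : (M : List ℕ) → All (λ m → 1 ≤ m) M → NonZero (lcmL M)
lcmL-nonZero []      []           = _
lcmL-nonZero (m ∷ M) (1≤m ∷ 1≤M) = ≢-nonZero λ lcm≡0 →
  ≢-nonZero⁻¹ (m * lcmL M) {{m*n≢0 m (lcmL M) {{>-nonZero 1≤m}} {{lcmL-nonZero M 1≤M}}}} (begin
    m * lcmL M                     ≡⟨ gcd*lcm m (lcmL M) ⟨
    gcd m (lcmL M) * lcm m (lcmL M) ≡⟨ cong (gcd m (lcmL M) *_) lcm≡0 ⟩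
    gcd m (lcmL M) * 0              ≡⟨ *-zeroʳ (gcd m (lcmL M)) ⟩
    0                               ∎)
  where open ≡-Reasoning

∈⇒∣lcmL : ∀ {M m} → m ∈ M → m ∣ lcmL M
∈⇒∣lcmL {m′ ∷ M} (here refl) = m∣lcm[m,n] m′ (lcmL M)
∈⇒∣lcmL {m′ ∷ M} (there m∈M) = ∣-trans (∈⇒∣lcmL m∈M) (n∣lcm[m,n] m′ (lcmL M))

lcmL-least : ∀ {M d} → All (_∣ d) M → lcmL M ∣ d
lcmL-least []           = 1∣ _
lcmL-least (m∣d ∷ M∣d) = lcm-least m∣d (lcmL-least M∣d)

EqM⇒≈[] : ∀ {M t a b} → EqM M t a b → Threshold._≈[_]_ (lcmL M) a t b
EqM⇒≈[] (inj₁ a≡b)              = inj₁ a≡b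
EqM⇒≈[] (inj₂ (t≤a , t≤b , a≡b)) = inj₂ (t≤a , t≤b , Congruence.∣⇒≈ _ (lcmL-least a≡b))

-- The statement's bound f(r) is twice the
-- threshold for rank r, so =^M_{f(r)} implies threshold equality of the
-- numbers of rows; the empty assignments then correspond, and the
-- back-and-forth argument transfers every sentence of rank at most r.
lemma4p6 : (M : List ℕ) → All (λ m → 1 ≤ m) M → (r k : ℕ) → 1 < k →
    (ℓ₁ ℓ₂ : ℕ) → 1 ≤ ℓ₁ → 1 ≤ ℓ₂ →
    EqM M ((2 ^ (k * r + 1) ∸ 2) * lcmL M) ℓ₁ ℓ₂ →
    EquivCMSO M r (grid k ℓ₁) (grid k ℓ₂)
lemma4p6 M 1≤M r k 1<k ℓ₁ ℓ₂ _ _ ℓ₁=ℓ₂ φ qrφ≤r =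
  mk⇔ (preserves r φ qrφ≤r start) (preserves r φ qrφ≤r (Corresponds-sym start))
  where
  instance
    lcm-nonZero : NonZero (lcmL M)
    lcm-nonZero = lcmL-nonZero M 1≤M
  open Threshold (lcmL M)
  open Correspondence k (lcmL M)
  open BackAndForth M k (lcmL M) (<⇒≤ 1<k) ∈⇒∣lcmL

  rows-threshold-equal : ℓ₁ ≈[ threshold r ] ℓ₂
  rows-threshold-equal = ≈[]-weaken threshold≤f (EqM⇒≈[] ℓ₁=ℓ₂)
    where
    threshold≤f : threshold r ≤ (2 ^ (k * r + 1) ∸ 2) * lcmL M
    threshold≤f = ≤-trans (m≤m+n (threshold r) (threshold r)) (≤-reflexive (sym (threshold-bound r)))

  start : Corresponds (threshold r) empty empty empty empty
  start = initial rows-threshold-equal
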